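{- For all integers $m,n\geq 0$, $$2I^m_n-m^n=I^{m+1}_n,$$ with the convention $0^0=1$.
   Context: Let $X_n=\{1,\dots,n\}$. A preferential arrangement of a finite set is an ordered set partition: a linearly ordered sequence of pairwise disjoint nonempty subsets (blocks) whose union is the set. A restricted barred preferential arrangement of $X_n$ with $m$ bars is a sequence of $m+1$ sections $S_1,\dots,S_{m+1}$, where the $S_i$ are pairwise disjoint, possibly empty, subsets with union $X_n$, such that each of the first $m$ sections $S_1,\dots,S_m$ consists of at most one block (it is either empty or a single block containing all its elements), while the last section $S_{m+1}$ (the free section) carries an arbitrary preferential arrangement of its elements (possibly empty, possibly with several blocks). $I^m_n$ denotes the number of restricted barred preferential arrangements of $X_n$ with $m$ bars; in particular $I^0_n$ is the number of preferential arrangements of $X_n$. -}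

module Defs where

open import Data.Nat using (ℕ; zero; suc)
open import Data.Fin using (Fin)
open import Data.Fin.Properties using (all?) renaming (_≟_ to _≟F_)
open import Data.Sum using (_⊎_; inj₁; inj₂)
open import Data.Sum.Properties using (≡-dec)
open import Data.Vec using (Vec; []; _∷_)
open import Data.Vec.Membership.Propositional using (_∈_)
import Data.Vec.Membership.DecPropositional as VecMem
open import Data.List using (List; [_]; _++_; map; concatMap; filter; length; upTo; allFin)
open import Data.Nat.ListAction using (sum)
open import Relation.Nullary using (Dec)
open import Relation.Binary.PropositionalEquality using (_≡_)

vecsOver : {A : Set} → List A → (n : ℕ) → List (Vec A n)
vecsOver xs zero    = [ [] ]
vecsOver xs (suc n) = concatMap (λ x → map (x ∷_) (vecsOver xs n)) xs

-- Section labels for an arrangement with m bars whose free section has k blocks: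
--   inj₁ i  : element lies in the restricted section S_(i+1)   (i < m)
--   inj₂ j  : element lies in the (j+1)-th block of the free section S_(m+1)  (j < k)
Label : ℕ → ℕ → Set
Label m k = Fin m ⊎ Fin k

labels : (m k : ℕ) → List (Label m k)
labels m k = map inj₁ (allFin m) ++ map inj₂ (allFin k)

_≟L_ : {m k : ℕ} → (x y : Label m k) → Dec (x ≡ y)
_≟L_ = ≡-dec _≟F_ _≟F_

-- A labelling v : X_n → Label m k encodes a restricted barred preferential
-- arrangement with m bars whose free section has exactly k (ordered, nonempty)
-- blocks iff every free block j is nonempty.  Restricted sections S_1..S_m are
-- the preimages of inj₁ i (each either empty or a single block).
FreeBlocksNonempty : {n m k : ℕ} → Vec (Label m k) n → Set
FreeBlocksNonempty {k = k} v = (j : Fin k) → inj₂ j ∈ v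

freeBlocksNonempty? : {n m k : ℕ} → (v : Vec (Label m k) n) → Dec (FreeBlocksNonempty v)
freeBlocksNonempty? {k = k} v = all? (λ j → VecMem._∈?_ _≟L_ (inj₂ j) v)

Ik : (m n k : ℕ) → ℕ
Ik m n k = length (filter freeBlocksNonempty? (vecsOver (labels m k) n))

I : (m n : ℕ) → ℕ
I m n = sum (map (Ik m n) (upTo (suc n)))

-- An arrangement with m bars whose free section has k blocks is a word of
-- length n over m + k letters in which each of the k block letters occurs.
-- Counting such words by their first letter gives the recurrence of
-- `covering`: the first letter is a bar letter, or one of the k block letters,
-- which is then already used and behaves like a bar letter for the rest of the
-- word.  From it follows the Pascal rule
--   covering (m + 1) n k = covering m n k + covering m n (k + 1),
-- i.e. a new bar letter is either unused or is a further block.  Summing over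
-- k ≤ n, I^(m+1)_n telescopes to 2 I^m_n - covering m n 0 (the term with
-- k = n + 1 vanishes), and covering m n 0 = m ^ n.
module Submission where

open import Defs
open import Data.Nat using (ℕ; zero; suc; pred; _+_; _*_; _^_; _<_; s≤s)
open import Data.Nat.Properties
  using (+-identityʳ; +-comm; +-assoc; +-suc; +-cancelˡ-≡; *-zeroʳ; m<n⇒m<1+n; n<1+n)
open import Data.Nat.ListAction using (sum)
open import Data.Nat.ListAction.Properties using (sum-++)
open import Data.Nat.Tactic.RingSolver using (solve-∀)
open import Data.Sum using (inj₁; inj₂)
open import Data.Sum.Properties using (inj₁-injective; inj₂-injective)
open import Data.Product using (_×_; _,_; proj₁; proj₂; ∃-syntax; curry)
open import Data.Empty using (⊥-elim)
open import Data.Vec using (Vec; []; _∷_)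
open import Data.Vec.Relation.Unary.Any using (here; there)
import Data.Vec.Membership.Propositional as VecMembership
import Data.Vec.Membership.DecPropositional as VecDecMembership
open import Data.List using (List; []; _∷_; _++_; _∷ʳ_; map; concatMap; filter; length; applyUpTo; upTo; allFin)
open import Data.List.Properties
  using ( length-++; length-map; length-tabulate; filter-++; filter-≐; filter-none; filter-all; filter-some
        ; map-cong; map-upTo; applyUpTo-∷ʳ)
open import Data.List.Relation.Unary.All as All using (All; []; _∷_)
open import Data.List.Relation.Unary.Any using (Any)
open import Data.List.Relation.Unary.AllPairs using (_∷_)
open import Data.List.Relation.Unary.Unique.Propositional using (Unique)
import Data.List.Relation.Unary.Unique.Propositional.Properties as Unique
open import Data.List.Relation.Binary.Subset.Propositional using (_⊆_)
open import Data.List.Membership.Propositional using (_∈_; _∉_; lose)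
open import Data.List.Membership.Propositional.Properties
  using (∈-filter⁺; ∈-filter⁻; ∈-map⁺; ∈-map⁻; ∈-++⁺ʳ; ∈-allFin)
import Data.List.Membership.DecPropositional as ListDecMembership
open import Function using (_∘_; id)
open import Relation.Nullary using (Dec; yes; no; ¬_; ¬?)
open import Relation.Unary using (Pred; Decidable; ∁; _≐_)
open import Relation.Unary.Properties using (∁?)
open import Relation.Binary.Definitions using (DecidableEquality)
open import Relation.Binary.PropositionalEquality
  using (_≡_; _≢_; refl; sym; trans; cong; cong₂; subst; module ≡-Reasoning)

open ≡-Reasoning

count : ∀ {a p} {A : Set a} {P : Pred A p} → Decidable P → List A → ℕ
count P? xs = length (filter P? xs)

module _ {a p} {A : Set a} {P : Pred A p} (P? : Decidable P) where

  count-++ : ∀ xs ys → count P? (xs ++ ys) ≡ count P? xs + count P? ys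
  count-++ xs ys = trans (cong length (filter-++ P? xs ys)) (length-++ (filter P? xs))

  count-concatMap : ∀ {b} {B : Set b} (f : B → List A) xs →
                    count P? (concatMap f xs) ≡ sum (map (count P? ∘ f) xs)
  count-concatMap f []       = refl
  count-concatMap f (x ∷ xs) = trans (count-++ (f x) (concatMap f xs))
                                     (cong (count P? (f x) +_) (count-concatMap f xs))

  count-map : ∀ {b} {B : Set b} (f : B → A) xs → count P? (map f xs) ≡ count (P? ∘ f) xs
  count-map f []       = refl
  count-map f (x ∷ xs) with P? (f x)
  ... | yes _ = cong suc (count-map f xs)
  ... | no  _ = count-map f xs

  count-none : ∀ {xs} → All (∁ P) xs → count P? xs ≡ 0
  count-none ¬Ps = cong length (filter-none P? ¬Ps)

  count-+-count-∁ : ∀ xs → count P? xs + count (∁? P?) xs ≡ length xs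
  count-+-count-∁ []       = refl
  count-+-count-∁ (x ∷ xs) with P? x
  ... | yes _ = cong suc (count-+-count-∁ xs)
  ... | no  _ = trans (+-suc _ _) (cong suc (count-+-count-∁ xs))

  sum-map-dichotomy : ∀ {f : A → ℕ} {c d} → (∀ {x} → P x → f x ≡ c) → (∀ {x} → ¬ P x → f x ≡ d) →
                      ∀ xs → sum (map f xs) ≡ count P? xs * c + count (∁? P?) xs * d
  sum-map-dichotomy f≡c f≡d []       = refl
  sum-map-dichotomy {c = c} {d} f≡c f≡d (x ∷ xs) with P? x
  ... | yes px = trans (cong₂ _+_ (f≡c px) (sum-map-dichotomy f≡c f≡d xs)) (sym (+-assoc c _ _))
  ... | no ¬px = trans (cong₂ _+_ (f≡d ¬px) (sum-map-dichotomy f≡c f≡d xs))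
                       (m+[n+o]≡n+[m+o] d (count P? xs * c) (count (∁? P?) xs * d))
    where
      m+[n+o]≡n+[m+o] : ∀ m n o → m + (n + o) ≡ n + (m + o)
      m+[n+o]≡n+[m+o] = solve-∀

sum-applyUpTo-cong : ∀ {f g : ℕ → ℕ} → (∀ i → f i ≡ g i) → ∀ N →
                     sum (applyUpTo f N) ≡ sum (applyUpTo g N)
sum-applyUpTo-cong f≗g zero    = refl
sum-applyUpTo-cong f≗g (suc N) = cong₂ _+_ (f≗g 0) (sum-applyUpTo-cong (f≗g ∘ suc) N)

sum-applyUpTo-+ : ∀ (f g : ℕ → ℕ) N →
                  sum (applyUpTo (λ i → f i + g i) N) ≡ sum (applyUpTo f N) + sum (applyUpTo g N)
sum-applyUpTo-+ f g zero    = refl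
sum-applyUpTo-+ f g (suc N) =
  trans (cong (f 0 + g 0 +_) (sum-applyUpTo-+ (f ∘ suc) (g ∘ suc) N))
        (interchange (f 0) (g 0) _ _)
  where
    interchange : ∀ a b c d → (a + b) + (c + d) ≡ (a + c) + (b + d)
    interchange = solve-∀

sum-applyUpTo-shift : ∀ (f : ℕ → ℕ) N → sum (applyUpTo (f ∘ suc) N) + f 0 ≡ sum (applyUpTo f N) + f N
sum-applyUpTo-shift f N = begin
  sum (applyUpTo (f ∘ suc) N) + f 0    ≡⟨ +-comm _ (f 0) ⟩
  sum (applyUpTo f (suc N))            ≡⟨ cong sum (applyUpTo-∷ʳ f N) ⟨
  sum (applyUpTo f N ∷ʳ f N)           ≡⟨ sum-++ (applyUpTo f N) _ ⟩
  sum (applyUpTo f N) + (f N + 0)      ≡⟨ cong (sum (applyUpTo f N) +_) (+-identityʳ (f N)) ⟩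
  sum (applyUpTo f N) + f N            ∎

covering : ℕ → ℕ → ℕ → ℕ
covering m zero    zero    = 1
covering m zero    (suc k) = 0
covering m (suc n) k       = m * covering m n k + k * covering (suc m) n (pred k)

covering-pascal : ∀ n m k → covering (suc m) n k ≡ covering m n k + covering m n (suc k)
covering-pascal zero    m zero    = refl
covering-pascal zero    m (suc k) = refl
covering-pascal (suc n) m k =
  begin
    suc m * E + k * covering (suc (suc m)) n (pred k)
  ≡⟨ cong (suc m * E +_) (scaled-pascal k) ⟩
    suc m * E + k * (D + E)
  ≡⟨ cong (λ e → suc m * e + k * (D + e)) (covering-pascal n m k) ⟩
    suc m * (A + B) + k * (D + (A + B))
  ≡⟨ rearrange m k A B D ⟩
    (m * A + k * D) + (m * B + suc k * (A + B))
  ≡⟨ cong (λ e → (m * A + k * D) + (m * B + suc k * e)) (covering-pascal n m k) ⟨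
    covering m (suc n) k + covering m (suc n) (suc k)
  ∎
  where
    A = covering m n k
    B = covering m n (suc k)
    D = covering (suc m) n (pred k)
    E = covering (suc m) n k

    -- The factor j makes the junk value pred 0 = 0 harmless.
    scaled-pascal : ∀ j → j * covering (suc (suc m)) n (pred j)
                        ≡ j * (covering (suc m) n (pred j) + covering (suc m) n j)
    scaled-pascal zero    = refl
    scaled-pascal (suc j) = cong (suc j *_) (covering-pascal n (suc m) j)

    rearrange : ∀ m k A B D → suc m * (A + B) + k * (D + (A + B))
                            ≡ (m * A + k * D) + (m * B + suc k * (A + B))
    rearrange = solve-∀

covering-zero : ∀ m n → covering m n 0 ≡ m ^ n
covering-zero m zero    = refl
covering-zero m (suc n) = trans (+-identityʳ (m * covering m n 0)) (cong (m *_) (covering-zero m n))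

covering-vanishes : ∀ m {n k} → n < k → covering m n k ≡ 0
covering-vanishes m {zero}  {suc k} _ = refl
covering-vanishes m {suc n} {suc k} (s≤s n<k) =
  cong₂ _+_ (trans (cong (m *_) (covering-vanishes m (m<n⇒m<1+n n<k))) (*-zeroʳ m))
            (trans (cong (suc k *_) (covering-vanishes (suc m) n<k)) (*-zeroʳ (suc k)))

module Covering {A : Set} (_≟_ : DecidableEquality A) where
  open VecMembership using () renaming (_∈_ to _∈ᵥ_)
  open VecDecMembership _≟_ using () renaming (_∈?_ to _∈ᵥ?_)
  open ListDecMembership _≟_ using (_∈?_)

  Covers : ∀ {n} → List A → Vec A n → Set
  Covers T v = All (_∈ᵥ v) T

  covers? : ∀ {n} T → Decidable (Covers {n} T)
  covers? T v = All.all? (_∈ᵥ? v) T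

  coverCount : List A → ℕ → List A → ℕ
  coverCount L n T = count (covers? T) (vecsOver L n)

  hits : List A → List A → ℕ
  hits L T = count (_∈? T) L

  _≢?_ : ∀ t x → Dec (t ≢ x)
  t ≢? x = ¬? (t ≟ x)

  remove : A → List A → List A
  remove x = filter (_≢? x)

  ∈-remove⁻ : ∀ {x t} T → t ∈ remove x T → t ∈ T × t ≢ x
  ∈-remove⁻ T = ∈-filter⁻ (_≢? _) {xs = T}

  ∈-remove⁺ : ∀ {x t T} → t ∈ T → t ≢ x → t ∈ remove x T
  ∈-remove⁺ = ∈-filter⁺ (_≢? _)

  remove-⊆ : ∀ {x T L} → T ⊆ L → remove x T ⊆ L
  remove-⊆ {T = T} T⊆L = T⊆L ∘ proj₁ ∘ ∈-remove⁻ T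

  covers-∷⁻ : ∀ {n x T} {v : Vec A n} → Covers T (x ∷ v) → Covers (remove x T) v
  covers-∷⁻ {x = x} {T} cov =
    All.tabulate λ t∈ → drop-head (∈-remove⁻ T t∈) (All.lookup cov (proj₁ (∈-remove⁻ T t∈)))
    where
      drop-head : ∀ {n t} {v : Vec A n} → t ∈ T × t ≢ x → t ∈ᵥ (x ∷ v) → t ∈ᵥ v
      drop-head (_ , t≢x) (here t≡x)  = ⊥-elim (t≢x t≡x)
      drop-head _         (there t∈v) = t∈v

  covers-∷⁺ : ∀ {n x T} {v : Vec A n} → Covers (remove x T) v → Covers T (x ∷ v)
  covers-∷⁺ {x = x} cov = All.tabulate covered
    where
      covered : ∀ {t} → t ∈ _ → t ∈ᵥ (x ∷ _)
      covered {t} t∈T with t ≟ x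
      ... | yes t≡x = here t≡x
      ... | no  t≢x = there (All.lookup cov (∈-remove⁺ t∈T t≢x))

  coverCount-suc : ∀ L n T → coverCount L (suc n) T ≡ sum (map (λ x → coverCount L n (remove x T)) L)
  coverCount-suc L n T =
    trans (count-concatMap (covers? T) (λ x → map (x ∷_) (vecsOver L n)) L)
          (cong sum (map-cong head-fixed L))
    where
      head-fixed : ∀ x → count (covers? T) (map (x ∷_) (vecsOver L n)) ≡ coverCount L n (remove x T)
      head-fixed x = trans (count-map (covers? T) (x ∷_) (vecsOver L n))
                           (cong length (filter-≐ _ (covers? (remove x T)) (covers-∷⁻ , covers-∷⁺) (vecsOver L n)))

  hits-remove-∉T : ∀ {x T} L → x ∉ T → hits L (remove x T) ≡ hits L T
  hits-remove-∉T {x} {T} L x∉T =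
    cong length (filter-≐ (_∈? remove x T) (_∈? T) (proj₁ ∘ ∈-remove⁻ T , kept) L)
    where
      kept : ∀ {t} → t ∈ T → t ∈ remove x T
      kept t∈T = ∈-remove⁺ t∈T (λ t≡x → x∉T (subst (_∈ T) t≡x t∈T))

  hits-remove-∉L : ∀ {x} T {L} → All (x ≢_) L → hits L (remove x T) ≡ hits L T
  hits-remove-∉L T [] = refl
  hits-remove-∉L {x} T {y ∷ L} (x≢y ∷ x∉L) with y ∈? remove x T | y ∈? T
  ... | yes _   | yes _   = cong suc (hits-remove-∉L T x∉L)
  ... | no  _   | no  _   = hits-remove-∉L T x∉L
  ... | yes y∈r | no  y∉T = ⊥-elim (y∉T (proj₁ (∈-remove⁻ T y∈r)))
  ... | no  y∉r | yes y∈T = ⊥-elim (y∉r (∈-remove⁺ y∈T (x≢y ∘ sym)))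

  hits-remove-∈ : ∀ {x T L} → Unique L → x ∈ L → x ∈ T → hits L T ≡ suc (hits L (remove x T))
  hits-remove-∈ {x} {T} (x∉L ∷ _) (Any.here refl) x∈T with x ∈? T | x ∈? remove x T
  ... | yes _   | no  _   = cong suc (sym (hits-remove-∉L T x∉L))
  ... | no  x∉T | _       = ⊥-elim (x∉T x∈T)
  ... | yes _   | yes x∈r = ⊥-elim (proj₂ (∈-remove⁻ T x∈r) refl)
  hits-remove-∈ {x} {T} {y ∷ L} (y∉L ∷ u) (Any.there x∈L) x∈T with y ∈? T | y ∈? remove x T
  ... | yes _   | yes _   = cong suc (hits-remove-∈ u x∈L x∈T)
  ... | no  _   | no  _   = hits-remove-∈ u x∈L x∈T
  ... | yes y∈T | no  y∉r = ⊥-elim (y∉r (∈-remove⁺ y∈T (All.lookup y∉L x∈L)))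
  ... | no  y∉T | yes y∈r = ⊥-elim (y∉T (proj₁ (∈-remove⁻ T y∈r)))

  coverCount≡covering : ∀ n {m L T} → Unique L → T ⊆ L → length L ≡ m + hits L T →
                        coverCount L n T ≡ covering m n (hits L T)
  coverCount≡covering zero {m} {L} {[]} _ _ _ =
    sym (cong (covering m 0) (count-none (_∈? []) {L} (All.tabulate λ _ ())))
  coverCount≡covering zero {m} {L} {t ∷ T} _ T⊆L _
    -- hits L (t ∷ T) = 0 is refuted by filter-some, as t ∈ L.
    with hits L (t ∷ T) | filter-some (_∈? t ∷ T) (lose (T⊆L (Any.here refl)) (Any.here refl))
  ... | suc _ | _ = refl
  coverCount≡covering (suc n) {m} {L} {T} u T⊆L ∣L∣≡m+h =
    begin
      coverCount L (suc n) T
    ≡⟨ coverCount-suc L n T ⟩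
      sum (map (λ x → coverCount L n (remove x T)) L)
    ≡⟨ sum-map-dichotomy (_∈? T) inside outside L ⟩
      h * covering (suc m) n (pred h) + misses * covering m n h
    ≡⟨ cong (λ k → h * covering (suc m) n (pred h) + k * covering m n h) misses≡m ⟩
      h * covering (suc m) n (pred h) + m * covering m n h
    ≡⟨ +-comm (h * covering (suc m) n (pred h)) _ ⟩
      covering m (suc n) h
    ∎
    where
      h = hits L T
      misses = count (∁? (_∈? T)) L

      misses≡m : misses ≡ m
      misses≡m = +-cancelˡ-≡ h _ _ (trans (count-+-count-∁ (_∈? T) L) (trans ∣L∣≡m+h (+-comm m h)))

      inside : ∀ {x} → x ∈ T → coverCount L n (remove x T) ≡ covering (suc m) n (pred h)
      inside x∈T =
        trans (coverCount≡covering n {suc m} u (remove-⊆ T⊆L) (trans ∣L∣≡m+h (trans (cong (m +_) h≡) (+-suc m _))))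
              (cong (covering (suc m) n ∘ pred) (sym h≡))
        where h≡ = hits-remove-∈ u (T⊆L x∈T) x∈T

      outside : ∀ {x} → x ∉ T → coverCount L n (remove x T) ≡ covering m n h
      outside x∉T =
        trans (coverCount≡covering n {m} u (remove-⊆ T⊆L) (trans ∣L∣≡m+h (cong (m +_) (sym h≡))))
              (cong (covering m n) h≡)
        where h≡ = hits-remove-∉T L x∉T

module _ (m k : ℕ) where
  open Covering (_≟L_ {m} {k})
  open ListDecMembership (_≟L_ {m} {k}) using (_∈?_)

  private
    bars blocks : List (Label m k)
    bars   = map inj₁ (allFin m)
    blocks = map inj₂ (allFin k)

    length-allFin : ∀ n → length (allFin n) ≡ n
    length-allFin n = length-tabulate {n = n} id

    bars-disjoint-blocks : ∀ {x} → ¬ (x ∈ bars × x ∈ blocks)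
    bars-disjoint-blocks (x∈bars , x∈blocks) with ∈-map⁻ inj₁ x∈bars | ∈-map⁻ inj₂ x∈blocks
    ... | _ , _ , refl | _ , _ , ()

    labels-unique : Unique (labels m k)
    labels-unique = Unique.++⁺ (Unique.map⁺ inj₁-injective (Unique.allFin⁺ m))
                               (Unique.map⁺ inj₂-injective (Unique.allFin⁺ k)) bars-disjoint-blocks

    hits-blocks : hits (labels m k) blocks ≡ k
    hits-blocks = begin
      hits (bars ++ blocks) blocks           ≡⟨ count-++ (_∈? blocks) bars blocks ⟩
      hits bars blocks + hits blocks blocks  ≡⟨ cong₂ _+_ (count-none (_∈? blocks) (All.tabulate (curry bars-disjoint-blocks)))
                                                          (cong length (filter-all (_∈? blocks) (All.tabulate id))) ⟩
      length blocks                          ≡⟨ length-map inj₂ (allFin k) ⟩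
      length (allFin k)                      ≡⟨ length-allFin k ⟩
      k                                      ∎

    length-labels : length (labels m k) ≡ m + hits (labels m k) blocks
    length-labels = begin
      length (bars ++ blocks)                ≡⟨ length-++ bars ⟩
      length bars + length blocks            ≡⟨ cong₂ _+_ (length-map inj₁ (allFin m)) (length-map inj₂ (allFin k)) ⟩
      length (allFin m) + length (allFin k)  ≡⟨ cong₂ _+_ (length-allFin m) (length-allFin k) ⟩
      m + k                                  ≡⟨ cong (m +_) (sym hits-blocks) ⟩
      m + hits (labels m k) blocks           ∎

    freeBlocksNonempty⇔covers : ∀ {n} → FreeBlocksNonempty {n} ≐ Covers blocks
    freeBlocksNonempty⇔covers = (λ nonempty → All.tabulate λ t∈ → block-hit (∈-map⁻ inj₂ t∈) nonempty)
                              , (λ cov j → All.lookup cov (∈-map⁺ inj₂ (∈-allFin j)))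
      where
        block-hit : ∀ {n t} {v : Vec (Label m k) n} →
                    ∃[ j ] j ∈ allFin k × t ≡ inj₂ j → FreeBlocksNonempty v → t VecMembership.∈ v
        block-hit (j , _ , refl) nonempty = nonempty j

  Ik≡covering : ∀ n → Ik m n k ≡ covering m n k
  Ik≡covering n = begin
    Ik m n k
      ≡⟨ cong length (filter-≐ freeBlocksNonempty? (covers? blocks) freeBlocksNonempty⇔covers (vecsOver (labels m k) n)) ⟩
    coverCount (labels m k) n blocks
      ≡⟨ coverCount≡covering n labels-unique (∈-++⁺ʳ bars) length-labels ⟩
    covering m n (hits (labels m k) blocks)
      ≡⟨ cong (covering m n) hits-blocks ⟩
    covering m n k
      ∎

I≡sum-covering : ∀ m n → I m n ≡ sum (applyUpTo (covering m n) (suc n))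
I≡sum-covering m n = trans (cong sum (map-cong (λ k → Ik≡covering m k n) (upTo (suc n))))
                           (cong sum (map-upTo (covering m n) (suc n)))

theorem3 : (m n : ℕ) → 2 * I m n ≡ m ^ n + I (suc m) n
-- 2 * x unfolds to x + (x + 0).
theorem3 m n = begin
  2 * I m n                        ≡⟨ cong (2 *_) (I≡sum-covering m n) ⟩
  Σ C + (Σ C + 0)                  ≡⟨ cong (λ x → Σ C + (Σ C + x)) (covering-vanishes m (n<1+n n)) ⟨
  Σ C + (Σ C + C (suc n))          ≡⟨ cong (Σ C +_) (sum-applyUpTo-shift C (suc n)) ⟨
  Σ C + (Σ (C ∘ suc) + C 0)        ≡⟨ trans (sym (+-assoc (Σ C) _ _)) (+-comm _ (C 0)) ⟩
  C 0 + (Σ C + Σ (C ∘ suc))        ≡⟨ cong (C 0 +_) (sum-applyUpTo-+ C (C ∘ suc) (suc n)) ⟨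
  C 0 + Σ (λ k → C k + C (suc k))  ≡⟨ cong (C 0 +_) (sum-applyUpTo-cong (covering-pascal n m) (suc n)) ⟨
  C 0 + Σ (covering (suc m) n)     ≡⟨ cong₂ _+_ (covering-zero m n) (sym (I≡sum-covering (suc m) n)) ⟩
  m ^ n + I (suc m) n              ∎
  where
    C = covering m n
    Σ : (ℕ → ℕ) → ℕ
    Σ f = sum (applyUpTo f (suc n))
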